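{- If a signed graph $(G,\sigma)$ has a $(k,d)$-coloring with $d$ odd, and $k'$ and $d'$ are positive integers such that $\frac{k}{d}=\frac{k'}{d'}$, then $(G,\sigma)$ has a $(k',d')$-coloring.
   Context: Graphs are simple and finite. A signed graph $(G,\sigma)$ is a graph $G$ with a map $\sigma:E(G)\to\{\pm1\}$. For $x\in\mathbb{R}$ and $r>0$, $[x]_r\in[0,r)$ is the remainder of $x$ modulo $r$ and $|x|_r=\min\{[x]_r,[-x]_r\}$. For positive integers $k\ge 2d$, a $(k,d)$-coloring of $(G,\sigma)$ is a map $c:V(G)\to\mathbb{Z}_k$ such that $|c(v)-\sigma(e)c(w)|_k\ge d$ for every edge $e=vw$. -}

module Defs where

open import Data.Nat as ℕ using (ℕ; NonZero; _≤_; _⊓_)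
open import Data.Integer as ℤ using (ℤ; +_; _-_; -_; _◃_; _%ℕ_)
open import Data.Sign using (Sign)
open import Data.Fin using (Fin; toℕ)
open import Data.Maybe using (Maybe; just; nothing)
open import Relation.Binary.PropositionalEquality using (_≡_)

-- A finite simple signed graph on vertex set Fin n.
-- sign u v ≡ nothing : u and v are not adjacent;
-- sign u v ≡ just s  : uv is an edge with sign s (Sign.+ = +1, Sign.- = -1).
record SignedGraph : Set where
  field
    n      : ℕ
    sign   : Fin n → Fin n → Maybe Sign
    irrefl : ∀ v → sign v v ≡ nothing
    sym    : ∀ u v → sign u v ≡ sign v u

[_]_ : ℤ → (r : ℕ) → .{{NonZero r}} → ℕ
[ x ] r = x %ℕ r

∣_∣_ : ℤ → (r : ℕ) → .{{NonZero r}} → ℕ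
∣ x ∣ r = ([ x ] r) ⊓ ([ - x ] r)

-- (k,d)-coloring: c : V(G) → ℤ_k with |c(v) - σ(e) c(w)|_k ≥ d for every edge e = vw.
-- (Elements of ℤ_k are represented by Fin k, i.e. residues 0..k-1.)
IsColoring : (G : SignedGraph) (k d : ℕ) .{{_ : NonZero k}} →
             (Fin (SignedGraph.n G) → Fin k) → Set
IsColoring G k d c = ∀ v w s → SignedGraph.sign G v w ≡ just s →
  d ≤ ∣ (+ toℕ (c v)) - (s ◃ toℕ (c w)) ∣ k

-- (G,σ) has a (k,d)-coloring (the notion presupposes k ≥ 2d, d ≥ 1, imposed in the statement).
HasColoring : (G : SignedGraph) (k d : ℕ) .{{_ : NonZero k}} → Set
HasColoring G k d = Σ (Fin (SignedGraph.n G) → Fin k) (IsColoring G k d)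
  where open import Data.Product using (Σ)

-- Send a colour x ∈ ℤ_k to the integer nearest to x · d′ / d, reduced mod k′. Since k d′ = k′ d
-- this map is well defined on residues, and rounding is monotone and shifts by exactly d′ when
-- its argument shifts by d, so colours at distance in [d, k − d] modulo k land at distance in
-- [d′, k′ − d′] modulo k′. Oddness of d rules out ties in the rounding, which makes it commute
-- with negation and hence with the edge signs.
module Submission where

open import Defs
open import Data.Nat as ℕ using (ℕ; NonZero)
import Data.Nat.Properties as ℕ
open import Data.Nat.DivMod using (m≡m%n+[m/n]*n)
open import Data.Integer
  using (ℤ; +_; _+_; _*_; -_; _-_; _≤_; _<_; _◃_; _%ℕ_; _/ℕ_; +≤+; +<+; -1ℤ)
  renaming (suc to sucℤ; ∣_∣ to ∣_∣ℤ)
import Data.Integer.Properties as ℤ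
open import Data.Integer.DivMod
  using (a≡a%ℕn+[a/ℕn]*n; n%ℕd<d; [n/ℕd]*d≤n; n<s[n/ℕd]*d)
open import Data.Integer.Tactic.RingSolver using (solve-∀)
open import Data.Sign using (Sign)
open import Data.Fin using (Fin; toℕ; fromℕ<)
open import Data.Fin.Properties using (toℕ-fromℕ<)
open import Data.Product using (_,_)
open import Relation.Binary.PropositionalEquality

private
  variable
    d d′ k k′ : ℕ
    i j x y : ℤ

pos-∸ : ∀ {m n} → n ℕ.≤ m → + (m ℕ.∸ n) ≡ + m - + n
pos-∸ {m} {n} n≤m = sym (trans (ℤ.m-n≡m⊖n m n) (ℤ.⊖-≥ n≤m))

+-cancelʳ-≡ : ∀ c → i + c ≡ j + c → i ≡ j
+-cancelʳ-≡ {i} {j} c eq = begin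
  i          ≡⟨ cancel i c ⟨
  i + c - c  ≡⟨ cong (_- c) eq ⟩
  j + c - c  ≡⟨ cancel j c ⟩
  j          ∎
  where
  open ≡-Reasoning
  cancel : ∀ a b → a + b - b ≡ a
  cancel = solve-∀

+-cancelˡ-≤ : ∀ c → c + i ≤ c + j → i ≤ j
+-cancelˡ-≤ {i} {j} c le = begin
  i            ≡⟨ cancel c i ⟨
  - c + (c + i) ≤⟨ ℤ.+-monoʳ-≤ (- c) le ⟩
  - c + (c + j) ≡⟨ cancel c j ⟩
  j            ∎
  where
  open ℤ.≤-Reasoning
  cancel : ∀ a b → - a + (a + b) ≡ b
  cancel = solve-∀

i≡j+[i-j] : ∀ i j → i ≡ j + (i - j)
i≡j+[i-j] = solve-∀

q*d≤i<s[p]*d⇒q≤p : ∀ {p q} d → q * + d ≤ i → i < sucℤ p * + d → q ≤ p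
q*d≤i<s[p]*d⇒q≤p {i} {p} {q} d qd≤i i<s[p]d = ℤ.≮⇒≥ λ p<q → ℤ.<-irrefl refl (begin-strict
  sucℤ p * + d  ≤⟨ ℤ.*-monoʳ-≤-nonNeg (+ d) (ℤ.i<j⇒suc[i]≤j p<q) ⟩
  q * + d       ≤⟨ qd≤i ⟩
  i             <⟨ i<s[p]d ⟩
  sucℤ p * + d  ∎)
  where open ℤ.≤-Reasoning

/ℕ-unique : ∀ {q r} d .{{_ : NonZero d}} → r ℕ.< d → i ≡ + r + q * + d → i /ℕ d ≡ q
/ℕ-unique {q = q} {r} d r<d refl = ℤ.≤-antisym
  (q*d≤i<s[p]*d⇒q≤p d ([n/ℕd]*d≤n _ d) (begin-strict
    + r + q * + d  <⟨ ℤ.+-monoˡ-< (q * + d) (+<+ r<d) ⟩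
    + d + q * + d  ≡⟨ ℤ.suc-* q (+ d) ⟨
    sucℤ q * + d   ∎))
  (q*d≤i<s[p]*d⇒q≤p d (ℤ.i≤j+i _ (+ r)) (n<s[n/ℕd]*d _ d))
  where open ℤ.≤-Reasoning

%ℕ-unique : ∀ {q r} d .{{_ : NonZero d}} → r ℕ.< d → i ≡ + r + q * + d → i %ℕ d ≡ r
%ℕ-unique {i} {q} {r} d r<d eq = ℤ.+-injective (+-cancelʳ-≡ {+ (i %ℕ d)} {+ r} (q * + d) (begin
  + (i %ℕ d) + q * + d         ≡⟨ cong (λ t → + (i %ℕ d) + t * + d) (/ℕ-unique {q = q} d r<d eq) ⟨
  + (i %ℕ d) + (i /ℕ d) * + d  ≡⟨ a≡a%ℕn+[a/ℕn]*n i d ⟨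
  i                            ≡⟨ eq ⟩
  + r + q * + d                ∎))
  where open ≡-Reasoning

/ℕ-+-* : ∀ i j d .{{_ : NonZero d}} → (i + j * + d) /ℕ d ≡ i /ℕ d + j
/ℕ-+-* i j d = /ℕ-unique {q = i /ℕ d + j} d (n%ℕd<d i d) (begin
  i + j * + d                            ≡⟨ cong (_+ j * + d) (a≡a%ℕn+[a/ℕn]*n i d) ⟩
  + (i %ℕ d) + (i /ℕ d) * + d + j * + d  ≡⟨ regroup (+ (i %ℕ d)) (i /ℕ d) j (+ d) ⟩
  + (i %ℕ d) + (i /ℕ d + j) * + d        ∎)
  where
  open ≡-Reasoning
  regroup : ∀ r q j d → r + q * d + j * d ≡ r + (q + j) * d
  regroup = solve-∀

/ℕ-mono-≤ : ∀ d .{{_ : NonZero d}} → i ≤ j → i /ℕ d ≤ j /ℕ d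
/ℕ-mono-≤ {i} {j} d i≤j =
  q*d≤i<s[p]*d⇒q≤p d (ℤ.≤-trans ([n/ℕd]*d≤n i d) i≤j) (n<s[n/ℕd]*d j d)

-[i]%ℕk≡k∸i%ℕk : ∀ i k .{{_ : NonZero k}} → 1 ℕ.≤ i %ℕ k → (- i) %ℕ k ≡ k ℕ.∸ i %ℕ k
-[i]%ℕk≡k∸i%ℕk i k 1≤r = %ℕ-unique {q = - (i /ℕ k) + -1ℤ} k (ℕ.∸-monoʳ-< 1≤r r≤k) (begin
  - i                                    ≡⟨ cong -_ (a≡a%ℕn+[a/ℕn]*n i k) ⟩
  - (+ r + q * + k)                      ≡⟨ negate (+ r) q (+ k) ⟩
  (+ k - + r) + (- q + -1ℤ) * + k        ≡⟨ cong (_+ (- q + -1ℤ) * + k) (pos-∸ r≤k) ⟨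
  + (k ℕ.∸ r) + (- q + -1ℤ) * + k        ∎)
  where
  open ≡-Reasoning
  r = i %ℕ k
  q = i /ℕ k
  r≤k : r ℕ.≤ k
  r≤k = ℕ.<⇒≤ (n%ℕd<d i k)
  negate : ∀ r q k → - (r + q * k) ≡ (k - r) + (- q + -1ℤ) * k
  negate = solve-∀

-- Distance in ℤ_k

record Apart (k d : ℕ) (x y : ℤ) : Set where
  constructor apart
  field
    m     : ℤ
    lower : y + m * + k + + d ≤ x
    upper : x + + d ≤ y + m * + k + + k

Apart-shift : ∀ i j → Apart k d x y → Apart k d (x + i * + k) (y + j * + k)
Apart-shift {k} {d} {x} {y} i j (apart m lower upper) = apart (m + i - j) (begin
    y + j * + k + (m + i - j) * + k + + d  ≡⟨ lhs y j m i (+ k) (+ d) ⟩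
    y + m * + k + + d + i * + k            ≤⟨ ℤ.+-monoˡ-≤ (i * + k) lower ⟩
    x + i * + k                            ∎) (begin
    x + i * + k + + d                      ≡⟨ rhs x i (+ k) (+ d) ⟩
    x + + d + i * + k                      ≤⟨ ℤ.+-monoˡ-≤ (i * + k) upper ⟩
    y + m * + k + + k + i * + k            ≡⟨ lhs y j m i (+ k) (+ k) ⟨
    y + j * + k + (m + i - j) * + k + + k  ∎)
  where
  open ℤ.≤-Reasoning
  lhs : ∀ y j m i k d → y + j * k + (m + i - j) * k + d ≡ y + m * k + d + i * k
  lhs = solve-∀
  rhs : ∀ x i k d → x + i * k + d ≡ x + d + i * k
  rhs = solve-∀

≤∣∣-intro : ∀ {r} q .{{_ : NonZero k}} → i ≡ + r + q * + k →
            1 ℕ.≤ d → d ℕ.≤ r → d ℕ.+ r ℕ.≤ k → d ℕ.≤ ∣ i ∣ k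
≤∣∣-intro {k} {i} {d} {r} q eq 1≤d d≤r d+r≤k = ℕ.⊓-glb
  (subst (d ℕ.≤_) (sym [i]≡r) d≤r)
  (subst (d ℕ.≤_) (sym [-i]≡k∸r) (ℕ.m+n≤o⇒m≤o∸n d d+r≤k))
  where
  [i]≡r : i %ℕ k ≡ r
  [i]≡r = %ℕ-unique {q = q} k (ℕ.<-≤-trans (ℕ.m<n+m r 1≤d) d+r≤k) eq
  [-i]≡k∸r : (- i) %ℕ k ≡ k ℕ.∸ r
  [-i]≡k∸r = trans (-[i]%ℕk≡k∸i%ℕk i k (subst (1 ℕ.≤_) (sym [i]≡r) (ℕ.≤-trans 1≤d d≤r)))
                   (cong (k ℕ.∸_) [i]≡r)

≤∣-∣⇒Apart : .{{_ : NonZero k}} → 1 ℕ.≤ d → d ℕ.≤ ∣ x - y ∣ k → Apart k d x y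
≤∣-∣⇒Apart {k} {d} {x} {y} 1≤d d≤∣x-y∣ = apart q (begin
    y + q * + k + + d  ≤⟨ ℤ.+-monoʳ-≤ (y + q * + k) (+≤+ d≤r) ⟩
    y + q * + k + + r  ≡⟨ x≡ ⟨
    x                  ∎) (begin
    x + + d                    ≡⟨ cong (_+ + d) x≡ ⟩
    y + q * + k + + r + + d    ≡⟨ swap (y + q * + k) (+ r) (+ d) ⟩
    y + q * + k + (+ d + + r)  ≡⟨ cong (λ t → y + q * + k + t) (ℤ.pos-+ d r) ⟨
    y + q * + k + + (d ℕ.+ r)  ≤⟨ ℤ.+-monoʳ-≤ (y + q * + k) (+≤+ d+r≤k) ⟩
    y + q * + k + + k          ∎)
  where
  open ℤ.≤-Reasoning
  r = (x - y) %ℕ k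
  q = (x - y) /ℕ k
  d≤r : d ℕ.≤ r
  d≤r = ℕ.≤-trans d≤∣x-y∣ (ℕ.m⊓n≤m _ _)
  d≤k∸r : d ℕ.≤ k ℕ.∸ r
  d≤k∸r = subst (d ℕ.≤_) (-[i]%ℕk≡k∸i%ℕk (x - y) k (ℕ.≤-trans 1≤d d≤r))
            (ℕ.≤-trans d≤∣x-y∣ (ℕ.m⊓n≤n _ _))
  d+r≤k : d ℕ.+ r ℕ.≤ k
  d+r≤k = ℕ.m≤o∸n⇒m+n≤o d (ℕ.<⇒≤ (n%ℕd<d (x - y) k)) d≤k∸r
  swap : ∀ a r d → a + r + d ≡ a + (d + r)
  swap = solve-∀
  x≡ : x ≡ y + q * + k + + r
  x≡ = begin-equality
    x                    ≡⟨ i≡j+[i-j] x y ⟩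
    y + (x - y)          ≡⟨ cong (λ t → y + t) (a≡a%ℕn+[a/ℕn]*n (x - y) k) ⟩
    y + (+ r + q * + k)  ≡⟨ reorder y (+ r) (q * + k) ⟩
    y + q * + k + + r    ∎
    where
    reorder : ∀ y r s → y + (r + s) ≡ y + s + r
    reorder = solve-∀

Apart⇒≤∣-∣ : .{{_ : NonZero k}} → 1 ℕ.≤ d → Apart k d x y → d ℕ.≤ ∣ x - y ∣ k
Apart⇒≤∣-∣ {k} {d} {x} {y} 1≤d (apart m lower upper) = ≤∣∣-intro m x-y≡n+mk 1≤d d≤n d+n≤k
  where
  open ℤ.≤-Reasoning
  y₀ = y + m * + k
  n = ∣ x - y₀ ∣ℤ
  x≡y₀+n : x ≡ y₀ + + n
  x≡y₀+n = trans (i≡j+[i-j] x y₀) (cong (λ t → y₀ + t)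
    (sym (ℤ.0≤i⇒+∣i∣≡i (ℤ.i≤j⇒0≤j-i (ℤ.≤-trans (ℤ.i≤i+j y₀ (+ d)) lower)))))
  d≤n : d ℕ.≤ n
  d≤n = ℤ.drop‿+≤+ (+-cancelˡ-≤ y₀ (subst (y₀ + + d ≤_) x≡y₀+n lower))
  d+n≤k : d ℕ.+ n ℕ.≤ k
  d+n≤k = ℤ.drop‿+≤+ (+-cancelˡ-≤ y₀ (begin
    y₀ + + (d ℕ.+ n)  ≡⟨ cong (λ t → y₀ + t) (ℤ.pos-+ d n) ⟩
    y₀ + (+ d + + n)  ≡⟨ swap y₀ (+ d) (+ n) ⟩
    y₀ + + n + + d    ≡⟨ cong (_+ + d) x≡y₀+n ⟨
    x + + d           ≤⟨ upper ⟩
    y₀ + + k          ∎))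
    where
    swap : ∀ a d n → a + (d + n) ≡ a + n + d
    swap = solve-∀
  x-y≡n+mk : x - y ≡ + n + m * + k
  x-y≡n+mk = trans (cong (_- y) x≡y₀+n) (cancel y m (+ k) (+ n))
    where
    cancel : ∀ y m k n → y + m * k + n - y ≡ n + m * k
    cancel = solve-∀

-- Rounding x · d′ / d to the nearest integer (halves rounded up)

rescale : (d′ d : ℕ) .{{_ : NonZero d}} → ℤ → ℤ
rescale d′ d x = (x * + d′ + + (d ℕ./ 2)) /ℕ d

module _ (d′ d : ℕ) .{{_ : NonZero d}} where

  rescale-+ : ∀ x i j → i * + d′ ≡ j * + d → rescale d′ d (x + i) ≡ rescale d′ d x + j
  rescale-+ x i j id′≡jd = begin
    ((x + i) * + d′ + h) /ℕ d          ≡⟨ cong (_/ℕ d) (expand x i (+ d′) h) ⟩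
    (x * + d′ + h + i * + d′) /ℕ d     ≡⟨ cong (λ t → (x * + d′ + h + t) /ℕ d) id′≡jd ⟩
    (x * + d′ + h + j * + d) /ℕ d      ≡⟨ /ℕ-+-* (x * + d′ + h) j d ⟩
    rescale d′ d x + j                 ∎
    where
    open ≡-Reasoning
    h = + (d ℕ./ 2)
    expand : ∀ x i d′ h → (x + i) * d′ + h ≡ x * d′ + h + i * d′
    expand = solve-∀

  rescale-mono-≤ : x ≤ y → rescale d′ d x ≤ rescale d′ d y
  rescale-mono-≤ x≤y = /ℕ-mono-≤ d (ℤ.+-monoˡ-≤ (+ (d ℕ./ 2)) (ℤ.*-monoʳ-≤-nonNeg (+ d′) x≤y))

  -- x · d′ / d is never a half-integer when d is odd, so rounding commutes with negation.
  rescale-neg : d ℕ.% 2 ≡ 1 → ∀ x → rescale d′ d (- x) ≡ - rescale d′ d x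
  rescale-neg d-odd x = /ℕ-unique {q = - q} d r′<d (begin
    - x * + d′ + + h                   ≡⟨ reflect x (+ d′) (+ h) ⟩
    + h * + 2 - (x * + d′ + + h)       ≡⟨ cong (λ t → + h * + 2 - t) (a≡a%ℕn+[a/ℕn]*n u d) ⟩
    + h * + 2 - (+ r + q * + d)        ≡⟨ regroup (+ h * + 2) (+ r) q (+ d) ⟩
    (+ h * + 2 - + r) + - q * + d      ≡⟨ cong (λ t → (t - + r) + - q * + d) (ℤ.pos-* h 2) ⟨
    (+ (h ℕ.* 2) - + r) + - q * + d    ≡⟨ cong (_+ - q * + d) (pos-∸ r≤2h) ⟨
    + (h ℕ.* 2 ℕ.∸ r) + - q * + d      ∎)
    where
    open ≡-Reasoning
    h = d ℕ./ 2
    u = x * + d′ + + h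
    r = u %ℕ d
    q = u /ℕ d
    d≡1+2h : d ≡ ℕ.suc (h ℕ.* 2)
    d≡1+2h = trans (m≡m%n+[m/n]*n d 2) (cong (ℕ._+ h ℕ.* 2) d-odd)
    r≤2h : r ℕ.≤ h ℕ.* 2
    r≤2h = ℕ.≤-pred (subst (r ℕ.<_) d≡1+2h (n%ℕd<d u d))
    r′<d : h ℕ.* 2 ℕ.∸ r ℕ.< d
    r′<d = subst (h ℕ.* 2 ℕ.∸ r ℕ.<_) (sym d≡1+2h) (ℕ.s≤s (ℕ.m∸n≤m (h ℕ.* 2) r))
    reflect : ∀ x d′ h → - x * d′ + h ≡ h * + 2 - (x * d′ + h)
    reflect = solve-∀
    regroup : ∀ a r q d → a - (r + q * d) ≡ (a - r) + - q * d
    regroup = solve-∀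

  rescale-Apart : ∀ {k k′} → k ℕ.* d′ ≡ k′ ℕ.* d →
                  Apart k d x y → Apart k′ d′ (rescale d′ d x) (rescale d′ d y)
  rescale-Apart {x} {y} {k} {k′} kd′≡k′d (apart m lower upper) = apart m (begin
      R y + m * + k′ + + d′  ≡⟨ R-shift (+ d) (+ d′) (ℤ.*-comm (+ d) (+ d′)) ⟨
      R (y + m * + k + + d)  ≤⟨ rescale-mono-≤ lower ⟩
      R x                    ∎) (begin
      R x + + d′             ≡⟨ rescale-+ x (+ d) (+ d′) (ℤ.*-comm (+ d) (+ d′)) ⟨
      R (x + + d)            ≤⟨ rescale-mono-≤ upper ⟩
      R (y + m * + k + + k)  ≡⟨ R-shift (+ k) (+ k′) k*d′≡k′*d ⟩
      R y + m * + k′ + + k′  ∎)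
    where
    open ℤ.≤-Reasoning
    R = rescale d′ d
    k*d′≡k′*d : + k * + d′ ≡ + k′ * + d
    k*d′≡k′*d = trans (sym (ℤ.pos-* k d′)) (trans (cong +_ kd′≡k′d) (ℤ.pos-* k′ d))
    mk*d′≡mk′*d : m * + k * + d′ ≡ m * + k′ * + d
    mk*d′≡mk′*d = begin-equality
      m * + k * + d′    ≡⟨ ℤ.*-assoc m (+ k) (+ d′) ⟩
      m * (+ k * + d′)  ≡⟨ cong (m *_) k*d′≡k′*d ⟩
      m * (+ k′ * + d)  ≡⟨ ℤ.*-assoc m (+ k′) (+ d) ⟨
      m * + k′ * + d    ∎
    R-shift : ∀ i j → i * + d′ ≡ j * + d → R (y + m * + k + i) ≡ R y + m * + k′ + j
    R-shift i j id′≡jd = trans (rescale-+ (y + m * + k) i j id′≡jd)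
                               (cong (_+ j) (rescale-+ y (m * + k) (m * + k′) mk*d′≡mk′*d))

signed : Sign → ℤ → ℤ
signed Sign.+ x = x
signed Sign.- x = - x

◃≡signed : ∀ s n → s ◃ n ≡ signed s (+ n)
◃≡signed Sign.+ n = ℤ.+◃n≡+n n
◃≡signed Sign.- n = ℤ.-◃n≡-n n

signed-+-* : ∀ s x i j → signed s (x + i * j) ≡ signed s x + signed s i * j
signed-+-* Sign.+ x i j = refl
signed-+-* Sign.- x i j = negate x i j
  where
  negate : ∀ x i j → - (x + i * j) ≡ - x + - i * j
  negate = solve-∀

rescale-signed : ∀ {d′ d} .{{_ : NonZero d}} → d ℕ.% 2 ≡ 1 →
                 ∀ s x → rescale d′ d (signed s x) ≡ signed s (rescale d′ d x)
rescale-signed d-odd Sign.+ x = refl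
rescale-signed d-odd Sign.- x = rescale-neg _ _ d-odd x

+[i%ℕk]≡i-[i/ℕk]*k : ∀ i k .{{_ : NonZero k}} → + (i %ℕ k) ≡ i + - (i /ℕ k) * + k
+[i%ℕk]≡i-[i/ℕk]*k i k = begin
  + (i %ℕ k)                                    ≡⟨ cancel (+ (i %ℕ k)) (i /ℕ k) (+ k) ⟨
  + (i %ℕ k) + (i /ℕ k) * + k + - (i /ℕ k) * + k  ≡⟨ cong (_+ - (i /ℕ k) * + k) (a≡a%ℕn+[a/ℕn]*n i k) ⟨
  i + - (i /ℕ k) * + k                          ∎
  where
  open ≡-Reasoning
  cancel : ∀ r q k → r + q * k + - q * k ≡ r
  cancel = solve-∀

Apart-%ℕ : ∀ s .{{_ : NonZero k}} → Apart k d x (signed s y) →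
           Apart k d (+ (x %ℕ k)) (signed s (+ (y %ℕ k)))
Apart-%ℕ {k} {d} {x} {y} s far = subst₂ (Apart k d)
  (sym (+[i%ℕk]≡i-[i/ℕk]*k x k))
  (sym (trans (cong (signed s) (+[i%ℕk]≡i-[i/ℕk]*k y k)) (signed-+-* s y (- (y /ℕ k)) (+ k))))
  (Apart-shift (- (x /ℕ k)) (signed s (- (y /ℕ k))) far)

rescale-preserves-edge : ∀ {k d k′ d′} .{{_ : NonZero k}} .{{_ : NonZero d}}
                         .{{_ : NonZero k′}} .{{_ : NonZero d′}} →
                         d ℕ.% 2 ≡ 1 → k ℕ.* d′ ≡ k′ ℕ.* d → ∀ a b s →
                         d ℕ.≤ ∣ + a - (s ◃ b) ∣ k →
                         d′ ℕ.≤ ∣ + (rescale d′ d (+ a) %ℕ k′) - (s ◃ (rescale d′ d (+ b) %ℕ k′)) ∣ k′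
rescale-preserves-edge {k} {d} {k′} {d′} d-odd kd′≡k′d a b s ab-far =
  subst (λ t → d′ ℕ.≤ ∣ + (R (+ a) %ℕ k′) - t ∣ k′) (sym (◃≡signed s (R (+ b) %ℕ k′)))
        (Apart⇒≤∣-∣ (ℕ.>-nonZero⁻¹ d′) (Apart-%ℕ s rescaled))
  where
  R = rescale d′ d
  far : Apart k d (+ a) (signed s (+ b))
  far = ≤∣-∣⇒Apart (ℕ.>-nonZero⁻¹ d) (subst (λ t → d ℕ.≤ ∣ + a - t ∣ k) (◃≡signed s b) ab-far)
  rescaled : Apart k′ d′ (R (+ a)) (signed s (R (+ b)))
  rescaled = subst (Apart k′ d′ (R (+ a))) (rescale-signed d-odd s (+ b))
                   (rescale-Apart d′ d kd′≡k′d far)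

proposition13 : (G : SignedGraph) (k d k′ d′ : ℕ)
    .{{_ : NonZero k}} .{{_ : NonZero d}} .{{_ : NonZero k′}} .{{_ : NonZero d′}} →
    2 ℕ.* d ℕ.≤ k → d ℕ.% 2 ≡ 1 →
    k ℕ.* d′ ≡ k′ ℕ.* d →
    HasColoring G k d → HasColoring G k′ d′
proposition13 G k d k′ d′ _ d-odd kd′≡k′d (c , c-proper) = c′ , c′-proper
  where
  colour : Fin (SignedGraph.n G) → ℤ
  colour v = rescale d′ d (+ toℕ (c v))
  c′ : Fin (SignedGraph.n G) → Fin k′
  c′ v = fromℕ< (n%ℕd<d (colour v) k′)
  c′-proper : IsColoring G k′ d′ c′
  c′-proper v w s vw≡s
    rewrite toℕ-fromℕ< (n%ℕd<d (colour v) k′) | toℕ-fromℕ< (n%ℕd<d (colour w) k′) =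
    rescale-preserves-edge d-odd kd′≡k′d (toℕ (c v)) (toℕ (c w)) s (c-proper v w s vw≡s)
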